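{- Let $a,b,r\geq 0$ be integers and $n\geq 0$ an integer. For each tuple $A=(0,m_1,\dots,m_6)$ below (whose entries are assumed nonnegative), let $\Lambda_A$ be the unique partition whose set of structure numbers is $\{c+7k:1\leq c\leq 6,\ 0\leq k<m_c\}$. Then: (1) (Type I) for $A=(0,a,b,r,2r-b,2r-a,2r)$: $\Lambda_A$ is a partition of $n$ iff $7n+14=(7r+3)^2+(7r+2-7a)^2+(7r+1-7b)^2$; (2) (Type II) for $A=(0,2r+1,a,b,r,2r-b,2r-a)$: $\Lambda_A$ is a partition of $n$ iff $7n+14=(7r+4)^2+(7r+2-7a)^2+(7r+1-7b)^2$; (3) (Type III) for $A=(0,a,2r+1-a,2r+1,b,r,2r-b)$: $\Lambda_A$ is a partition of $n$ iff $7n+14=(7r+5)^2+(7r+4-7a)^2+(7r+1-7b)^2$; (4) (Type IV) for $A=(0,a,b,2r+1-b,2r+1-a,2r+1,r)$: $\Lambda_A$ is a partition of $n$ iff $7n+14=(7r+6)^2+(7r+5-7a)^2+(7r+4-7b)^2$; (5) (Type V) for $A=(0,r+1,2r+2,a,b,2r+1-b,2r+1-a)$: $\Lambda_A$ is a partition of $n$ iff $7n+14=(7r+8)^2+(7r+5-7a)^2+(7r+4-7b)^2$; (6) (Type VI) for $A=(0,a,r+1,2r+2-a,2r+2,b,2r+1-b)$: $\Lambda_A$ is a partition of $n$ iff $7n+14=(7r+9)^2+(7r+8-7a)^2+(7r+4-7b)^2$.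
   Context: For a partition $\Lambda=(\lambda_1\geq\dots\geq\lambda_s>0)$ with $s$ positive parts, the structure numbers are $B_j=\lambda_j-j+s$, $1\leq j\leq s$. Conversely, any finite set of $s$ positive integers $B_1>\dots>B_s$ is the set of structure numbers of the unique partition with $\lambda_j=B_j+j-s$. The tuple $(0,m_1,\dots,m_6)$ is the $7$-abacus (bead counts per residue class modulo $7$) of the corresponding partition, which is a $7$-core. -}

module Defs where

open import Data.Nat using (ℕ; suc; _+_; _*_; _∸_)
open import Data.Nat.Properties using (≤-decTotalOrder)
open import Data.List using (List; []; _∷_; map; concat; upTo; length; reverse; zipWith)
open import Data.Nat.ListAction using (sum)
open import Relation.Binary.PropositionalEquality using (_≡_)
open import Data.List.Sort ≤-decTotalOrder using (sort)

structureNumbers : ℕ → ℕ → ℕ → ℕ → ℕ → ℕ → List ℕ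
structureNumbers m₁ m₂ m₃ m₄ m₅ m₆ =
  concat ( runner 1 m₁ ∷ runner 2 m₂ ∷ runner 3 m₃ ∷ runner 4 m₄
         ∷ runner 5 m₅ ∷ runner 6 m₆ ∷ [] )
  where
  runner : ℕ → ℕ → List ℕ
  runner c m = map (λ k → c + 7 * k) (upTo m)

partitionFromStructureNumbers : List ℕ → List ℕ
partitionFromStructureNumbers xs =
  zipWith (λ j b → b + j ∸ s) (map suc (upTo s)) B
  where
  B : List ℕ
  B = reverse (sort xs)
  s : ℕ
  s = length B

Λ : ℕ → ℕ → ℕ → ℕ → ℕ → ℕ → List ℕ
Λ m₁ m₂ m₃ m₄ m₅ m₆ = partitionFromStructureNumbers (structureNumbers m₁ m₂ m₃ m₄ m₅ m₆)

PartitionOf : List ℕ → ℕ → Set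
PartitionOf λs n = sum λs ≡ n

module Submission where

-- Let y_c = c + 7 m_c be the first empty position on runner c (so y_0 = 0) and ȳ = m₁ + ⋯ + m₆ + 3
-- the mean of y_0, …, y_6.  Since λ_j = B_j − (s − j), the size of Λ is Σ B_j − s(s − 1)/2, and
-- summing the bead positions runner by runner turns this into
--   2 (7 |Λ| + 14) = Σ_c y_c² − 7 ȳ² = Σ_c (y_c − ȳ)².
-- In each of the six families the gaps lie symmetrically about ȳ = u, at offsets 0, ±u, ±v, ±w,
-- so the right-hand side is 2 (u² + v² + w²).

module SizeFormula where

  open import Defs
  open import Data.Nat using (ℕ; zero; suc; _+_; _*_; _∸_; _%_; _≤_; _<_; _>_; _<?_; _≟_; z≤n; s≤s; NonZero)
  open import Data.Nat.DivMod using ([m+kn]%n≡m%n; m<n⇒m%n≡m)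
  open import Data.Nat.Properties
  open import Data.Nat.ListAction using (sum)
  open import Data.Nat.ListAction.Properties using (sum-↭; sum-++)
  open import Data.List using (List; []; _∷_; _++_; _∷ʳ_; [_]; map; concatMap; upTo; applyUpTo; length; reverse; zipWith)
  open import Data.List.Properties using (unfold-reverse; map-upTo; length-reverse; length-++; length-map; length-upTo; upTo-∷ʳ; map-++)
  open import Data.List.Membership.Propositional using (_∈_)
  open import Data.List.Membership.Propositional.Properties using (∈-map⁻; ∈-++⁻)
  open import Data.List.Relation.Unary.Any using (here; there)
  open import Data.List.Relation.Unary.All as All using (All; []; _∷_)
  import Data.List.Relation.Unary.All.Properties as All
  open import Data.List.Relation.Unary.AllPairs as AllPairs using (AllPairs; []; _∷_)
  import Data.List.Relation.Unary.AllPairs.Properties as AllPairs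
  open import Data.List.Relation.Unary.Unique.Propositional using (Unique)
  open import Data.List.Relation.Unary.Unique.DecPropositional _≟_ using (unique?)
  open import Relation.Nullary.Decidable using (from-yes)
  import Data.List.Relation.Unary.Unique.Propositional.Properties as Unique
  open import Data.List.Relation.Unary.Sorted.TotalOrder.Properties using (Sorted⇒AllPairs)
  open import Data.List.Relation.Binary.Permutation.Propositional using (↭-sym; ↭-trans; ↭⇒↭ₛ)
  import Data.List.Relation.Binary.Permutation.Setoid.Properties as Permutation
  open import Data.List.Relation.Binary.Permutation.Propositional.Properties using (↭-reverse; ↭-length)
  open import Data.List.Sort ≤-decTotalOrder using (sort; sort-↭; sort-↗)
  open import Data.Product using (_×_; _,_; proj₁; proj₂; uncurry)
  open import Data.Sum using (inj₁; inj₂)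
  open import Function using (flip; _∘_)
  open import Relation.Binary.PropositionalEquality using (_≡_; refl; sym; trans; cong; cong₂; setoid; module ≡-Reasoning)
  open import Data.Nat.Tactic.RingSolver using (solve-∀)

  triangle : ℕ → ℕ
  triangle zero    = 0
  triangle (suc n) = n + triangle n

  2*triangle+n≡n*n : ∀ n → 2 * triangle n + n ≡ n * n
  2*triangle+n≡n*n zero    = refl
  2*triangle+n≡n*n (suc n) = begin
    2 * (n + triangle n) + suc n    ≡⟨ regroup n (triangle n) ⟩
    (2 * triangle n + n) + 2 * n + 1 ≡⟨ cong (λ x → x + 2 * n + 1) (2*triangle+n≡n*n n) ⟩
    n * n + 2 * n + 1               ≡⟨ square-suc n ⟩
    suc n * suc n                   ∎
    where
    open ≡-Reasoning
    regroup : ∀ n t → 2 * (n + t) + suc n ≡ (2 * t + n) + 2 * n + 1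
    regroup = solve-∀
    square-suc : ∀ n → n * n + 2 * n + 1 ≡ suc n * suc n
    square-suc = solve-∀

  All-reverse : ∀ {P : ℕ → Set} {xs} → All P xs → All P (reverse xs)
  All-reverse {xs = []}     []         = []
  All-reverse {xs = x ∷ xs} (px ∷ pxs) rewrite unfold-reverse x xs = All.++⁺ (All-reverse pxs) (px ∷ [])

  AllPairs-reverse : ∀ {R : ℕ → ℕ → Set} {xs} → AllPairs R xs → AllPairs (flip R) (reverse xs)
  AllPairs-reverse {xs = []}     []         = []
  AllPairs-reverse {xs = x ∷ xs} (rx ∷ rxs) rewrite unfold-reverse x xs =
    AllPairs.++⁺ (AllPairs-reverse rxs) ([] ∷ []) (All.map (_∷ []) (All-reverse rx))

  sort-strictlyIncreasing : ∀ {xs} → Unique xs → AllPairs _<_ (sort xs)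
  sort-strictlyIncreasing {xs} xs! = AllPairs.zipWith (λ (x≤y , x≢y) → ≤∧≢⇒< x≤y x≢y)
    (Sorted⇒AllPairs ≤-totalOrder (sort-↗ xs) , Permutation.Unique-resp-↭ (setoid ℕ) (↭⇒↭ₛ (↭-sym (sort-↭ xs))) xs!)

  strictlyDecreasing⇒length≤ : ∀ {b bs} → All (_< b) bs → AllPairs _>_ bs → length bs ≤ b
  strictlyDecreasing⇒length≤ []             []         = z≤n
  strictlyDecreasing⇒length≤ (c<b ∷ bs<b) (c>bs ∷ bs>) = ≤-trans (s≤s (strictlyDecreasing⇒length≤ c>bs bs>)) c<b

  sum-zipWith-∸ : ∀ s f {bs} → AllPairs _>_ bs → (∀ i → f i + length bs ≡ s + suc i) →
    sum (zipWith (λ j b → b + j ∸ s) (applyUpTo f (length bs)) bs) + triangle (length bs) ≡ sum bs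
  sum-zipWith-∸ s f []                       f≡ = refl
  sum-zipWith-∸ s f {b ∷ bs} (b>bs ∷ bs>) f≡ = begin
    (b + f 0 ∸ s) + rest + (L + triangle L) ≡⟨ cong (λ x → x + rest + (L + triangle L)) head≡ ⟩
    (b ∸ L) + rest + (L + triangle L)       ≡⟨ regroup (b ∸ L) rest L (triangle L) ⟩
    (b ∸ L + L) + (rest + triangle L)       ≡⟨ cong₂ _+_ (m∸n+n≡m (strictlyDecreasing⇒length≤ b>bs bs>)) tail≡ ⟩
    b + sum bs                              ∎
    where
    open ≡-Reasoning
    L : ℕ
    L = length bs
    rest : ℕ
    rest = sum (zipWith (λ j b → b + j ∸ s) (applyUpTo (λ i → f (suc i)) L) bs)
    regroup : ∀ x z l t → x + z + (l + t) ≡ (x + l) + (z + t)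
    regroup = solve-∀
    s≡ : s ≡ f 0 + L
    s≡ = sym (suc-injective (trans (sym (+-suc (f 0) L)) (trans (f≡ 0) (+-comm s 1))))
    head≡ : b + f 0 ∸ s ≡ b ∸ L
    head≡ rewrite s≡ | +-comm b (f 0) = [m+n]∸[m+o]≡n∸o (f 0) b L
    tail≡ : rest + triangle L ≡ sum bs
    tail≡ = sum-zipWith-∸ s (λ i → f (suc i)) bs>
      (λ i → suc-injective (trans (sym (+-suc (f (suc i)) L)) (trans (f≡ (suc i)) (+-suc s (suc i)))))

  sum-partitionFromStructureNumbers : ∀ {xs} → Unique xs →
    sum (partitionFromStructureNumbers xs) + triangle (length xs) ≡ sum xs
  sum-partitionFromStructureNumbers {xs} xs! = begin
    sum (zipWith part (map suc (upTo s)) bs) + triangle (length xs)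
      ≡⟨ cong₂ (λ js l → sum (zipWith part js bs) + triangle l) (map-upTo suc s) (sym length≡) ⟩
    sum (zipWith part (applyUpTo suc s) bs) + triangle s
      ≡⟨ sum-zipWith-∸ s suc decreasing (λ i → +-comm (suc i) s) ⟩
    sum bs
      ≡⟨ sum-↭ (↭-trans (↭-reverse (sort xs)) (sort-↭ xs)) ⟩
    sum xs
      ∎
    where
    open ≡-Reasoning
    bs : List ℕ
    bs = reverse (sort xs)
    s : ℕ
    s = length bs
    part : ℕ → ℕ → ℕ
    part j b = b + j ∸ s
    length≡ : s ≡ length xs
    length≡ = trans (length-reverse (sort xs)) (↭-length (sort-↭ xs))
    decreasing : AllPairs _>_ bs
    decreasing = AllPairs-reverse (sort-strictlyIncreasing xs!)

  module Abacus (t : ℕ) .{{_ : NonZero t}} where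

    runner : ℕ → ℕ → List ℕ
    runner c m = map (λ k → c + t * k) (upTo m)

    beads : List (ℕ × ℕ) → List ℕ
    beads = concatMap (uncurry runner)

    length-beads : ∀ ps → length (beads ps) ≡ sum (map proj₂ ps)
    length-beads []            = refl
    length-beads ((c , m) ∷ ps) = begin
      length (runner c m ++ beads ps)
        ≡⟨ length-++ (runner c m) ⟩
      length (runner c m) + length (beads ps)
        ≡⟨ cong₂ _+_ (trans (length-map _ (upTo m)) (length-upTo m)) (length-beads ps) ⟩
      m + sum (map proj₂ ps)
        ∎
      where open ≡-Reasoning

    runner-unique : ∀ c m → Unique (runner c m)
    runner-unique c m = Unique.map⁺ (λ {k} {l} eq → *-cancelˡ-≡ k l t (+-cancelˡ-≡ c _ _ eq)) (Unique.upTo⁺ m)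

    ∈-runner⇒% : ∀ {c m v} → c < t → v ∈ runner c m → v % t ≡ c
    ∈-runner⇒% {c} c<t v∈ with ∈-map⁻ (λ k → c + t * k) v∈
    ... | k , _ , refl = trans (cong (λ x → (c + x) % t) (*-comm t k)) (trans ([m+kn]%n≡m%n c k t) (m<n⇒m%n≡m c<t))

    ∈-beads⇒% : ∀ {ps v} → All ((_< t) ∘ proj₁) ps → v ∈ beads ps → v % t ∈ map proj₁ ps
    ∈-beads⇒% {(c , m) ∷ ps} (c<t ∷ ps<t) v∈ with ∈-++⁻ (runner c m) v∈
    ... | inj₁ v∈runner = here (∈-runner⇒% c<t v∈runner)
    ... | inj₂ v∈beads  = there (∈-beads⇒% ps<t v∈beads)

    beads-unique : ∀ {ps} → All ((_< t) ∘ proj₁) ps → Unique (map proj₁ ps) → Unique (beads ps)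
    beads-unique {[]}           []           []          = []
    beads-unique {(c , m) ∷ ps} (c<t ∷ ps<t) (c∉ ∷ ps!) = Unique.++⁺ (runner-unique c m) (beads-unique ps<t ps!)
      λ (v∈runner , v∈beads) → All.lookup c∉ (∈-beads⇒% ps<t v∈beads) (sym (∈-runner⇒% c<t v∈runner))

    sum-runner-suc : ∀ c m → sum (runner c (suc m)) ≡ sum (runner c m) + (c + t * m)
    sum-runner-suc c m = begin
      sum (map f (upTo (suc m)))           ≡⟨ cong (sum ∘ map f) (upTo-∷ʳ m) ⟨
      sum (map f (upTo m ∷ʳ m))            ≡⟨ cong sum (map-++ f (upTo m) [ m ]) ⟩
      sum (map f (upTo m) ++ [ f m ])      ≡⟨ sum-++ (map f (upTo m)) [ f m ] ⟩
      sum (map f (upTo m)) + (f m + 0)     ≡⟨ cong (sum (map f (upTo m)) +_) (+-identityʳ (f m)) ⟩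
      sum (map f (upTo m)) + f m           ∎
      where
      open ≡-Reasoning
      f : ℕ → ℕ
      f k = c + t * k

    sum-runner : ∀ c m → 2 * sum (runner c m) + t * m ≡ 2 * c * m + t * (m * m)
    sum-runner c zero    = cong (_+ t * 0) (sym (*-zeroʳ (2 * c)))
    sum-runner c (suc m) = begin
      2 * sum (runner c (suc m)) + t * suc m    ≡⟨ cong (λ x → 2 * x + t * suc m) (sum-runner-suc c m) ⟩
      2 * (S + (c + t * m)) + t * suc m         ≡⟨ regroup S c m t ⟩
      (2 * S + t * m) + (2 * c + 2 * t * m + t) ≡⟨ cong (_+ (2 * c + 2 * t * m + t)) (sum-runner c m) ⟩
      2 * c * m + t * (m * m) + (2 * c + 2 * t * m + t) ≡⟨ expand c m t ⟩
      2 * c * suc m + t * (suc m * suc m)       ∎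
      where
      open ≡-Reasoning
      S : ℕ
      S = sum (runner c m)
      regroup : ∀ S c m t → 2 * (S + (c + t * m)) + t * suc m ≡ (2 * S + t * m) + (2 * c + 2 * t * m + t)
      regroup = solve-∀
      expand : ∀ c m t → 2 * c * m + t * (m * m) + (2 * c + 2 * t * m + t) ≡ 2 * c * suc m + t * (suc m * suc m)
      expand = solve-∀

    gap : ℕ × ℕ → ℕ
    gap (c , m) = c + t * m

    gap²-runner : ∀ c m → gap (c , m) * gap (c , m) ≡ c * c + t * (2 * sum (runner c m) + t * m)
    gap²-runner c m = begin
      (c + t * m) * (c + t * m)                   ≡⟨ expand c m t ⟩
      c * c + t * (2 * c * m + t * (m * m))       ≡⟨ cong (λ x → c * c + t * x) (sum-runner c m) ⟨
      c * c + t * (2 * sum (runner c m) + t * m)  ∎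
      where
      open ≡-Reasoning
      expand : ∀ c m t → (c + t * m) * (c + t * m) ≡ c * c + t * (2 * c * m + t * (m * m))
      expand = solve-∀

    sum-gap² : ∀ ps → sum (map (λ p → gap p * gap p) ps)
                      ≡ sum (map (λ p → proj₁ p * proj₁ p) ps) + t * (2 * sum (beads ps) + t * sum (map proj₂ ps))
    sum-gap² []             = sym (trans (cong (t *_) (*-zeroʳ t)) (*-zeroʳ t))
    sum-gap² ((c , m) ∷ ps) = begin
      gap (c , m) * gap (c , m) + sum (map (λ p → gap p * gap p) ps)
        ≡⟨ cong₂ _+_ (gap²-runner c m) (sum-gap² ps) ⟩
      (c * c + t * (2 * S + t * m)) + (C + t * (2 * S′ + t * M))
        ≡⟨ regroup (c * c) C S S′ m M t ⟩
      (c * c + C) + t * (2 * (S + S′) + t * (m + M))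
        ≡⟨ cong (λ x → (c * c + C) + t * (2 * x + t * (m + M))) (sum-++ (runner c m) (beads ps)) ⟨
      (c * c + C) + t * (2 * sum (runner c m ++ beads ps) + t * (m + M))
        ∎
      where
      open ≡-Reasoning
      S S′ C M : ℕ
      S = sum (runner c m)
      S′ = sum (beads ps)
      C = sum (map (λ p → proj₁ p * proj₁ p) ps)
      M = sum (map proj₂ ps)
      regroup : ∀ x C S S′ m M t → (x + t * (2 * S + t * m)) + (C + t * (2 * S′ + t * M))
                                   ≡ (x + C) + t * (2 * (S + S′) + t * (m + M))
      regroup = solve-∀

  open Abacus 7

  sevenAbacus : ℕ → ℕ → ℕ → ℕ → ℕ → ℕ → List (ℕ × ℕ)
  sevenAbacus m₁ m₂ m₃ m₄ m₅ m₆ = (1 , m₁) ∷ (2 , m₂) ∷ (3 , m₃) ∷ (4 , m₄) ∷ (5 , m₅) ∷ (6 , m₆) ∷ []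

  structureNumbers-unique : ∀ m₁ m₂ m₃ m₄ m₅ m₆ → Unique (structureNumbers m₁ m₂ m₃ m₄ m₅ m₆)
  structureNumbers-unique m₁ m₂ m₃ m₄ m₅ m₆ = beads-unique
    (from-yes (All.all? ((_<? 7) ∘ proj₁) (sevenAbacus m₁ m₂ m₃ m₄ m₅ m₆)))
    (from-yes (unique? (1 ∷ 2 ∷ 3 ∷ 4 ∷ 5 ∷ 6 ∷ [])))

  size-arithmetic : ∀ {P T L S} → P + T ≡ S → 2 * T + L ≡ L * L →
    2 * (7 * P + 14) + 7 * ((L + 3) * (L + 3)) ≡ 91 + 7 * (2 * S + 7 * L)
  size-arithmetic {P} {T} {L} refl 2T+L≡L² = begin
    2 * (7 * P + 14) + 7 * ((L + 3) * (L + 3)) ≡⟨ expand P L ⟩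
    7 * (2 * P + L * L + 6 * L) + 91           ≡⟨ cong (λ x → 7 * (2 * P + x + 6 * L) + 91) 2T+L≡L² ⟨
    7 * (2 * P + (2 * T + L) + 6 * L) + 91     ≡⟨ collect P T L ⟩
    91 + 7 * (2 * (P + T) + 7 * L)             ∎
    where
    open ≡-Reasoning
    expand : ∀ P L → 2 * (7 * P + 14) + 7 * ((L + 3) * (L + 3)) ≡ 7 * (2 * P + L * L + 6 * L) + 91
    expand = solve-∀
    collect : ∀ P T L → 7 * (2 * P + (2 * T + L) + 6 * L) + 91 ≡ 91 + 7 * (2 * (P + T) + 7 * L)
    collect = solve-∀

  size-Λ : ∀ m₁ m₂ m₃ m₄ m₅ m₆ →
    2 * (7 * sum (Λ m₁ m₂ m₃ m₄ m₅ m₆) + 14)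
      + 7 * ((m₁ + m₂ + m₃ + m₄ + m₅ + m₆ + 3) * (m₁ + m₂ + m₃ + m₄ + m₅ + m₆ + 3))
    ≡ gap (1 , m₁) * gap (1 , m₁) + gap (2 , m₂) * gap (2 , m₂) + gap (3 , m₃) * gap (3 , m₃)
      + gap (4 , m₄) * gap (4 , m₄) + gap (5 , m₅) * gap (5 , m₅) + gap (6 , m₆) * gap (6 , m₆)
  size-Λ m₁ m₂ m₃ m₄ m₅ m₆ = begin
    2 * (7 * sum (Λ m₁ m₂ m₃ m₄ m₅ m₆) + 14) + 7 * ((L′ + 3) * (L′ + 3))
      ≡⟨ cong (λ x → 2 * (7 * sum (Λ m₁ m₂ m₃ m₄ m₅ m₆) + 14) + 7 * ((x + 3) * (x + 3))) (reassoc m₁ m₂ m₃ m₄ m₅ m₆) ⟨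
    2 * (7 * sum (Λ m₁ m₂ m₃ m₄ m₅ m₆) + 14) + 7 * ((L + 3) * (L + 3))
      ≡⟨ size-arithmetic {P = sum (Λ m₁ m₂ m₃ m₄ m₅ m₆)} partition-sum (2*triangle+n≡n*n L) ⟩
    91 + 7 * (2 * sum (beads ps) + 7 * L)
      ≡⟨ sum-gap² ps ⟨
    sum (map (λ p → gap p * gap p) ps)
      ≡⟨ reassoc (gap² (1 , m₁)) (gap² (2 , m₂)) (gap² (3 , m₃)) (gap² (4 , m₄)) (gap² (5 , m₅)) (gap² (6 , m₆)) ⟩
    gap² (1 , m₁) + gap² (2 , m₂) + gap² (3 , m₃) + gap² (4 , m₄) + gap² (5 , m₅) + gap² (6 , m₆)
      ∎
    where
    open ≡-Reasoning
    ps : List (ℕ × ℕ)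
    ps = sevenAbacus m₁ m₂ m₃ m₄ m₅ m₆
    L L′ : ℕ
    L = sum (map proj₂ ps)
    L′ = m₁ + m₂ + m₃ + m₄ + m₅ + m₆
    gap² : ℕ × ℕ → ℕ
    gap² p = gap p * gap p
    reassoc : ∀ x₁ x₂ x₃ x₄ x₅ x₆ → x₁ + (x₂ + (x₃ + (x₄ + (x₅ + (x₆ + 0))))) ≡ x₁ + x₂ + x₃ + x₄ + x₅ + x₆
    reassoc = solve-∀
    partition-sum : sum (Λ m₁ m₂ m₃ m₄ m₅ m₆) + triangle L ≡ sum (beads ps)
    partition-sum = trans (cong (λ l → sum (Λ m₁ m₂ m₃ m₄ m₅ m₆) + triangle l) (sym (length-beads ps)))
                          (sum-partitionFromStructureNumbers (structureNumbers-unique m₁ m₂ m₃ m₄ m₅ m₆))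

module SquaresCriterion where

  open import Defs
  open SizeFormula using (size-Λ; module Abacus)
  open Abacus 7 using (gap)
  import Data.Nat as ℕ
  open import Data.Nat using (ℕ; _≤_)
  import Data.Nat.Properties as ℕ
  open import Data.Nat.ListAction using (sum)
  open import Data.Integer using (+_; _+_; _-_; _*_; _^_)
  open import Data.Integer.Properties using (pos-*; ⊖-≥; [+m]-[+n]≡m⊖n; *-identityʳ; *-cancelˡ-≡; +-injective; +-0-abelianGroup)
  open import Algebra.Properties.AbelianGroup +-0-abelianGroup using (∙-cancelʳ)
  open import Data.Product using (_,_)
  open import Function.Bundles using (_⇔_; mk⇔)
  open import Relation.Binary.PropositionalEquality using (_≡_; refl; sym; trans; cong; cong₂; subst)
  open import Data.Integer.Tactic.RingSolver using (solve-∀)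

  pos-∸ : ∀ {m n x} → + m ≡ x → n ≤ m → + (m ℕ.∸ n) ≡ x - + n
  pos-∸ {m} {n} refl n≤m = trans (sym (⊖-≥ n≤m)) (sym ([+m]-[+n]≡m⊖n m n))

  pos-2*+ : ∀ r k → + (2 ℕ.* r ℕ.+ k) ≡ + 2 * + r + + k
  pos-2*+ r k = cong (_+ + k) (pos-* 2 r)

  x^2≡y*y : ∀ {x y} → x ≡ y → x ^ 2 ≡ y * y
  x^2≡y*y {x} refl = cong (x *_) (*-identityʳ x)

  -- The ring solver does not understand _^_, so the squares are rewritten as products.
  threeSquares-ringForm : ∀ r a b k l j →
    (+ (7 ℕ.* r ℕ.+ k)) ^ 2 + (+ (7 ℕ.* r ℕ.+ l) - + (7 ℕ.* a)) ^ 2 + (+ (7 ℕ.* r ℕ.+ j) - + (7 ℕ.* b)) ^ 2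
    ≡ (+ 7 * + r + + k) * (+ 7 * + r + + k) + (+ 7 * + r + + l - + 7 * + a) * (+ 7 * + r + + l - + 7 * + a)
      + (+ 7 * + r + + j - + 7 * + b) * (+ 7 * + r + + j - + 7 * + b)
  threeSquares-ringForm r a b k l j = cong₂ _+_
    (cong₂ _+_ (x^2≡y*y (cong (_+ + k) (pos-* 7 r))) (x^2≡y*y (cong₂ (λ x y → x + + l - y) (pos-* 7 r) (pos-* 7 a))))
    (x^2≡y*y (cong₂ (λ x y → x + + j - y) (pos-* 7 r) (pos-* 7 b)))

  pos-gap² : ∀ c m → + (gap (c , m) ℕ.* gap (c , m)) ≡ (+ c + + 7 * + m) * (+ c + + 7 * + m)
  pos-gap² c m = trans (pos-* (gap (c , m)) (gap (c , m))) (cong (λ x → x * x) (cong (λ x → + c + x) (pos-* 7 m)))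

  pos-size-Λ : ∀ m₁ m₂ m₃ m₄ m₅ m₆ →
    + 2 * + (7 ℕ.* sum (Λ m₁ m₂ m₃ m₄ m₅ m₆) ℕ.+ 14)
      + + 7 * ((+ m₁ + + m₂ + + m₃ + + m₄ + + m₅ + + m₆ + + 3) * (+ m₁ + + m₂ + + m₃ + + m₄ + + m₅ + + m₆ + + 3))
    ≡ (+ 1 + + 7 * + m₁) * (+ 1 + + 7 * + m₁) + (+ 2 + + 7 * + m₂) * (+ 2 + + 7 * + m₂)
      + (+ 3 + + 7 * + m₃) * (+ 3 + + 7 * + m₃) + (+ 4 + + 7 * + m₄) * (+ 4 + + 7 * + m₄)
      + (+ 5 + + 7 * + m₅) * (+ 5 + + 7 * + m₅) + (+ 6 + + 7 * + m₆) * (+ 6 + + 7 * + m₆)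
  pos-size-Λ m₁ m₂ m₃ m₄ m₅ m₆ = trans (sym pos-lhs) (trans (cong +_ (size-Λ m₁ m₂ m₃ m₄ m₅ m₆))
    (cong₂ _+_ (cong₂ _+_ (cong₂ _+_ (cong₂ _+_ (cong₂ _+_ (pos-gap² 1 m₁) (pos-gap² 2 m₂)) (pos-gap² 3 m₃))
      (pos-gap² 4 m₄)) (pos-gap² 5 m₅)) (pos-gap² 6 m₆)))
    where
    N : ℕ
    N = 7 ℕ.* sum (Λ m₁ m₂ m₃ m₄ m₅ m₆) ℕ.+ 14
    L : ℕ
    L = m₁ ℕ.+ m₂ ℕ.+ m₃ ℕ.+ m₄ ℕ.+ m₅ ℕ.+ m₆ ℕ.+ 3
    pos-lhs : + (2 ℕ.* N ℕ.+ 7 ℕ.* (L ℕ.* L)) ≡ + 2 * + N + + 7 * (+ L * + L)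
    pos-lhs = cong₂ _+_ (pos-* 2 N) (trans (pos-* 7 (L ℕ.* L)) (cong (+ 7 *_) (pos-* L L)))

  -- Each family supplies its bead counts as integer polynomials xᵢ in a, b, r; what remains is
  -- a polynomial identity for the ring solver.
  size-criterion : ∀ m₁ m₂ m₃ m₄ m₅ m₆ n {x₁ x₂ x₃ x₄ x₅ x₆ Q Q′} → Q ≡ Q′ →
    + m₁ ≡ x₁ → + m₂ ≡ x₂ → + m₃ ≡ x₃ → + m₄ ≡ x₄ → + m₅ ≡ x₅ → + m₆ ≡ x₆ →
    (+ 1 + + 7 * x₁) * (+ 1 + + 7 * x₁) + (+ 2 + + 7 * x₂) * (+ 2 + + 7 * x₂)
      + (+ 3 + + 7 * x₃) * (+ 3 + + 7 * x₃) + (+ 4 + + 7 * x₄) * (+ 4 + + 7 * x₄)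
      + (+ 5 + + 7 * x₅) * (+ 5 + + 7 * x₅) + (+ 6 + + 7 * x₆) * (+ 6 + + 7 * x₆)
    ≡ + 2 * Q′ + + 7 * ((x₁ + x₂ + x₃ + x₄ + x₅ + x₆ + + 3) * (x₁ + x₂ + x₃ + x₄ + x₅ + x₆ + + 3)) →
    PartitionOf (Λ m₁ m₂ m₃ m₄ m₅ m₆) n ⇔ (+ (7 ℕ.* n ℕ.+ 14) ≡ Q)
  size-criterion m₁ m₂ m₃ m₄ m₅ m₆ n {Q = Q} refl refl refl refl refl refl refl gaps≡ =
    mk⇔ (λ P≡n → subst (λ k → + (7 ℕ.* k ℕ.+ 14) ≡ Q) P≡n size≡)
        (λ eq → ℕ.*-cancelˡ-≡ P n 7 (ℕ.+-cancelʳ-≡ 14 (7 ℕ.* P) (7 ℕ.* n) (+-injective (trans size≡ (sym eq)))))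
    where
    P : ℕ
    P = sum (Λ m₁ m₂ m₃ m₄ m₅ m₆)
    size≡ : + (7 ℕ.* P ℕ.+ 14) ≡ Q
    size≡ = *-cancelˡ-≡ (+ 2) _ _ (∙-cancelʳ _ _ _ (trans (pos-size-Λ m₁ m₂ m₃ m₄ m₅ m₆) gaps≡))

  typeI-gaps : ∀ a b r →
    (+ 1 + + 7 * a) * (+ 1 + + 7 * a)
      + (+ 2 + + 7 * b) * (+ 2 + + 7 * b)
      + (+ 3 + + 7 * r) * (+ 3 + + 7 * r)
      + (+ 4 + + 7 * (+ 2 * r - b)) * (+ 4 + + 7 * (+ 2 * r - b))
      + (+ 5 + + 7 * (+ 2 * r - a)) * (+ 5 + + 7 * (+ 2 * r - a))
      + (+ 6 + + 7 * (+ 2 * r)) * (+ 6 + + 7 * (+ 2 * r))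
    ≡ + 2 * ((+ 7 * r + + 3) * (+ 7 * r + + 3)
             + (+ 7 * r + + 2 - + 7 * a) * (+ 7 * r + + 2 - + 7 * a)
             + (+ 7 * r + + 1 - + 7 * b) * (+ 7 * r + + 1 - + 7 * b))
      + + 7 * ((a + b + r + (+ 2 * r - b) + (+ 2 * r - a) + + 2 * r + + 3)
               * (a + b + r + (+ 2 * r - b) + (+ 2 * r - a) + + 2 * r + + 3))
  typeI-gaps = solve-∀

  typeII-gaps : ∀ a b r →
    (+ 1 + + 7 * (+ 2 * r + + 1)) * (+ 1 + + 7 * (+ 2 * r + + 1))
      + (+ 2 + + 7 * a) * (+ 2 + + 7 * a)
      + (+ 3 + + 7 * b) * (+ 3 + + 7 * b)
      + (+ 4 + + 7 * r) * (+ 4 + + 7 * r)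
      + (+ 5 + + 7 * (+ 2 * r - b)) * (+ 5 + + 7 * (+ 2 * r - b))
      + (+ 6 + + 7 * (+ 2 * r - a)) * (+ 6 + + 7 * (+ 2 * r - a))
    ≡ + 2 * ((+ 7 * r + + 4) * (+ 7 * r + + 4)
             + (+ 7 * r + + 2 - + 7 * a) * (+ 7 * r + + 2 - + 7 * a)
             + (+ 7 * r + + 1 - + 7 * b) * (+ 7 * r + + 1 - + 7 * b))
      + + 7 * ((+ 2 * r + + 1 + a + b + r + (+ 2 * r - b) + (+ 2 * r - a) + + 3)
               * (+ 2 * r + + 1 + a + b + r + (+ 2 * r - b) + (+ 2 * r - a) + + 3))
  typeII-gaps = solve-∀

  typeIII-gaps : ∀ a b r →
    (+ 1 + + 7 * a) * (+ 1 + + 7 * a)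
      + (+ 2 + + 7 * (+ 2 * r + + 1 - a)) * (+ 2 + + 7 * (+ 2 * r + + 1 - a))
      + (+ 3 + + 7 * (+ 2 * r + + 1)) * (+ 3 + + 7 * (+ 2 * r + + 1))
      + (+ 4 + + 7 * b) * (+ 4 + + 7 * b)
      + (+ 5 + + 7 * r) * (+ 5 + + 7 * r)
      + (+ 6 + + 7 * (+ 2 * r - b)) * (+ 6 + + 7 * (+ 2 * r - b))
    ≡ + 2 * ((+ 7 * r + + 5) * (+ 7 * r + + 5)
             + (+ 7 * r + + 4 - + 7 * a) * (+ 7 * r + + 4 - + 7 * a)
             + (+ 7 * r + + 1 - + 7 * b) * (+ 7 * r + + 1 - + 7 * b))
      + + 7 * ((a + (+ 2 * r + + 1 - a) + (+ 2 * r + + 1) + b + r + (+ 2 * r - b) + + 3)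
               * (a + (+ 2 * r + + 1 - a) + (+ 2 * r + + 1) + b + r + (+ 2 * r - b) + + 3))
  typeIII-gaps = solve-∀

  typeIV-gaps : ∀ a b r →
    (+ 1 + + 7 * a) * (+ 1 + + 7 * a)
      + (+ 2 + + 7 * b) * (+ 2 + + 7 * b)
      + (+ 3 + + 7 * (+ 2 * r + + 1 - b)) * (+ 3 + + 7 * (+ 2 * r + + 1 - b))
      + (+ 4 + + 7 * (+ 2 * r + + 1 - a)) * (+ 4 + + 7 * (+ 2 * r + + 1 - a))
      + (+ 5 + + 7 * (+ 2 * r + + 1)) * (+ 5 + + 7 * (+ 2 * r + + 1))
      + (+ 6 + + 7 * r) * (+ 6 + + 7 * r)
    ≡ + 2 * ((+ 7 * r + + 6) * (+ 7 * r + + 6)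
             + (+ 7 * r + + 5 - + 7 * a) * (+ 7 * r + + 5 - + 7 * a)
             + (+ 7 * r + + 4 - + 7 * b) * (+ 7 * r + + 4 - + 7 * b))
      + + 7 * ((a + b + (+ 2 * r + + 1 - b) + (+ 2 * r + + 1 - a) + (+ 2 * r + + 1) + r + + 3)
               * (a + b + (+ 2 * r + + 1 - b) + (+ 2 * r + + 1 - a) + (+ 2 * r + + 1) + r + + 3))
  typeIV-gaps = solve-∀

  typeV-gaps : ∀ a b r →
    (+ 1 + + 7 * (r + + 1)) * (+ 1 + + 7 * (r + + 1))
      + (+ 2 + + 7 * (+ 2 * r + + 2)) * (+ 2 + + 7 * (+ 2 * r + + 2))
      + (+ 3 + + 7 * a) * (+ 3 + + 7 * a)
      + (+ 4 + + 7 * b) * (+ 4 + + 7 * b)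
      + (+ 5 + + 7 * (+ 2 * r + + 1 - b)) * (+ 5 + + 7 * (+ 2 * r + + 1 - b))
      + (+ 6 + + 7 * (+ 2 * r + + 1 - a)) * (+ 6 + + 7 * (+ 2 * r + + 1 - a))
    ≡ + 2 * ((+ 7 * r + + 8) * (+ 7 * r + + 8)
             + (+ 7 * r + + 5 - + 7 * a) * (+ 7 * r + + 5 - + 7 * a)
             + (+ 7 * r + + 4 - + 7 * b) * (+ 7 * r + + 4 - + 7 * b))
      + + 7 * ((r + + 1 + (+ 2 * r + + 2) + a + b + (+ 2 * r + + 1 - b) + (+ 2 * r + + 1 - a) + + 3)
               * (r + + 1 + (+ 2 * r + + 2) + a + b + (+ 2 * r + + 1 - b) + (+ 2 * r + + 1 - a) + + 3))
  typeV-gaps = solve-∀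

  typeVI-gaps : ∀ a b r →
    (+ 1 + + 7 * a) * (+ 1 + + 7 * a)
      + (+ 2 + + 7 * (r + + 1)) * (+ 2 + + 7 * (r + + 1))
      + (+ 3 + + 7 * (+ 2 * r + + 2 - a)) * (+ 3 + + 7 * (+ 2 * r + + 2 - a))
      + (+ 4 + + 7 * (+ 2 * r + + 2)) * (+ 4 + + 7 * (+ 2 * r + + 2))
      + (+ 5 + + 7 * b) * (+ 5 + + 7 * b)
      + (+ 6 + + 7 * (+ 2 * r + + 1 - b)) * (+ 6 + + 7 * (+ 2 * r + + 1 - b))
    ≡ + 2 * ((+ 7 * r + + 9) * (+ 7 * r + + 9)
             + (+ 7 * r + + 8 - + 7 * a) * (+ 7 * r + + 8 - + 7 * a)
             + (+ 7 * r + + 4 - + 7 * b) * (+ 7 * r + + 4 - + 7 * b))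
      + + 7 * ((a + (r + + 1) + (+ 2 * r + + 2 - a) + (+ 2 * r + + 2) + b + (+ 2 * r + + 1 - b) + + 3)
               * (a + (r + + 1) + (+ 2 * r + + 2 - a) + (+ 2 * r + + 2) + b + (+ 2 * r + + 1 - b) + + 3))
  typeVI-gaps = solve-∀

open import Defs
open import Data.Nat using (ℕ; _+_; _*_; _∸_; _≤_)
open import Data.Integer using (+_; _-_; _^_) renaming (_+_ to _+ℤ_)
open import Relation.Binary.PropositionalEquality using (_≡_; refl)
open import Function.Bundles using (_⇔_)
open import Data.Product using (_×_; _,_)
open import Data.Integer.Properties using (pos-*)
open SquaresCriterion

mainTheorem10 :
    ((a b r n : ℕ) → a ≤ 2 * r → b ≤ 2 * r →
      (PartitionOf (Λ a b r (2 * r ∸ b) (2 * r ∸ a) (2 * r)) n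
        ⇔ (+ (7 * n + 14) ≡ (+ (7 * r + 3)) ^ 2 +ℤ (+ (7 * r + 2) - + (7 * a)) ^ 2 +ℤ (+ (7 * r + 1) - + (7 * b)) ^ 2)))
    × ((a b r n : ℕ) → a ≤ 2 * r → b ≤ 2 * r →
      (PartitionOf (Λ (2 * r + 1) a b r (2 * r ∸ b) (2 * r ∸ a)) n
        ⇔ (+ (7 * n + 14) ≡ (+ (7 * r + 4)) ^ 2 +ℤ (+ (7 * r + 2) - + (7 * a)) ^ 2 +ℤ (+ (7 * r + 1) - + (7 * b)) ^ 2)))
    × ((a b r n : ℕ) → a ≤ 2 * r + 1 → b ≤ 2 * r →
      (PartitionOf (Λ a (2 * r + 1 ∸ a) (2 * r + 1) b r (2 * r ∸ b)) n
        ⇔ (+ (7 * n + 14) ≡ (+ (7 * r + 5)) ^ 2 +ℤ (+ (7 * r + 4) - + (7 * a)) ^ 2 +ℤ (+ (7 * r + 1) - + (7 * b)) ^ 2)))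
    × ((a b r n : ℕ) → a ≤ 2 * r + 1 → b ≤ 2 * r + 1 →
      (PartitionOf (Λ a b (2 * r + 1 ∸ b) (2 * r + 1 ∸ a) (2 * r + 1) r) n
        ⇔ (+ (7 * n + 14) ≡ (+ (7 * r + 6)) ^ 2 +ℤ (+ (7 * r + 5) - + (7 * a)) ^ 2 +ℤ (+ (7 * r + 4) - + (7 * b)) ^ 2)))
    × ((a b r n : ℕ) → a ≤ 2 * r + 1 → b ≤ 2 * r + 1 →
      (PartitionOf (Λ (r + 1) (2 * r + 2) a b (2 * r + 1 ∸ b) (2 * r + 1 ∸ a)) n
        ⇔ (+ (7 * n + 14) ≡ (+ (7 * r + 8)) ^ 2 +ℤ (+ (7 * r + 5) - + (7 * a)) ^ 2 +ℤ (+ (7 * r + 4) - + (7 * b)) ^ 2)))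
    × ((a b r n : ℕ) → a ≤ 2 * r + 2 → b ≤ 2 * r + 1 →
      (PartitionOf (Λ a (r + 1) (2 * r + 2 ∸ a) (2 * r + 2) b (2 * r + 1 ∸ b)) n
        ⇔ (+ (7 * n + 14) ≡ (+ (7 * r + 9)) ^ 2 +ℤ (+ (7 * r + 8) - + (7 * a)) ^ 2 +ℤ (+ (7 * r + 4) - + (7 * b)) ^ 2)))
mainTheorem10 =
    (λ a b r n a≤ b≤ → size-criterion a b r (2 * r ∸ b) (2 * r ∸ a) (2 * r) n (threeSquares-ringForm r a b 3 2 1)
       refl refl refl (pos-∸ (pos-* 2 r) b≤) (pos-∸ (pos-* 2 r) a≤) (pos-* 2 r) (typeI-gaps (+ a) (+ b) (+ r)))
  , (λ a b r n a≤ b≤ → size-criterion (2 * r + 1) a b r (2 * r ∸ b) (2 * r ∸ a) n (threeSquares-ringForm r a b 4 2 1)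
       (pos-2*+ r 1) refl refl refl (pos-∸ (pos-* 2 r) b≤) (pos-∸ (pos-* 2 r) a≤) (typeII-gaps (+ a) (+ b) (+ r)))
  , (λ a b r n a≤ b≤ → size-criterion a (2 * r + 1 ∸ a) (2 * r + 1) b r (2 * r ∸ b) n (threeSquares-ringForm r a b 5 4 1)
       refl (pos-∸ (pos-2*+ r 1) a≤) (pos-2*+ r 1) refl refl (pos-∸ (pos-* 2 r) b≤) (typeIII-gaps (+ a) (+ b) (+ r)))
  , (λ a b r n a≤ b≤ → size-criterion a b (2 * r + 1 ∸ b) (2 * r + 1 ∸ a) (2 * r + 1) r n (threeSquares-ringForm r a b 6 5 4)
       refl refl (pos-∸ (pos-2*+ r 1) b≤) (pos-∸ (pos-2*+ r 1) a≤) (pos-2*+ r 1) refl (typeIV-gaps (+ a) (+ b) (+ r)))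
  , (λ a b r n a≤ b≤ → size-criterion (r + 1) (2 * r + 2) a b (2 * r + 1 ∸ b) (2 * r + 1 ∸ a) n (threeSquares-ringForm r a b 8 5 4)
       refl (pos-2*+ r 2) refl refl (pos-∸ (pos-2*+ r 1) b≤) (pos-∸ (pos-2*+ r 1) a≤) (typeV-gaps (+ a) (+ b) (+ r)))
  , (λ a b r n a≤ b≤ → size-criterion a (r + 1) (2 * r + 2 ∸ a) (2 * r + 2) b (2 * r + 1 ∸ b) n (threeSquares-ringForm r a b 9 8 4)
       refl refl (pos-∸ (pos-2*+ r 2) a≤) (pos-2*+ r 2) refl (pos-∸ (pos-2*+ r 1) b≤) (typeVI-gaps (+ a) (+ b) (+ r)))
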